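{- (Consistency.) $\mathsf{IEL}^{ - }$ is consistent: there is no deduction of $\bot$ in $\mathsf{IEL}^{ - }$ without undischarged assumptions.
   Context: Formulas: built from propositional atoms and $\bot$ by $\wedge,\vee,\rightarrow$ and a unary modality $\Box$. $\mathsf{IEL}^{ - }$ is the natural deduction system with the usual intuitionistic (NJ) introduction/elimination rules for $\wedge,\vee,\rightarrow$, ex falso ($\bot$-elimination), and the $\Box$-intro rule: from deductions of $\Box A_1,\dots,\Box A_n$ (from assumptions $\Gamma_1,\dots,\Gamma_n$) and a deduction of $B$ from assumptions $A_1,\dots,A_n,\Delta$, infer $\Box B$, discharging $A_1,\dots,A_n$ ($n\ge0$). -}

module Defs where

open import Data.Nat using (ℕ)
open import Data.List using (List; []; _∷_; _++_; map)
open import Data.List.Membership.Propositional using (_∈_)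
open import Data.List.Relation.Unary.All using (All)

infixr 6 _∧_
infixr 5 _∨_
infixr 4 _⇒_

data Form : Set where
  atom : ℕ → Form
  ⊥'   : Form
  _∧_  : Form → Form → Form
  _∨_  : Form → Form → Form
  _⇒_  : Form → Form → Form
  □_   : Form → Form

Ctx : Set
Ctx = List Form

infix 2 _⊢_
data _⊢_ (Γ : Ctx) : Form → Set where
  hyp   : ∀ {A} → A ∈ Γ → Γ ⊢ A
  ∧I    : ∀ {A B} → Γ ⊢ A → Γ ⊢ B → Γ ⊢ A ∧ B
  ∧E₁   : ∀ {A B} → Γ ⊢ A ∧ B → Γ ⊢ A
  ∧E₂   : ∀ {A B} → Γ ⊢ A ∧ B → Γ ⊢ B
  ∨I₁   : ∀ {A B} → Γ ⊢ A → Γ ⊢ A ∨ B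
  ∨I₂   : ∀ {A B} → Γ ⊢ B → Γ ⊢ A ∨ B
  ∨E    : ∀ {A B C} → Γ ⊢ A ∨ B → (A ∷ Γ) ⊢ C → (B ∷ Γ) ⊢ C → Γ ⊢ C
  ⇒I    : ∀ {A B} → (A ∷ Γ) ⊢ B → Γ ⊢ A ⇒ B
  ⇒E    : ∀ {A B} → Γ ⊢ A ⇒ B → Γ ⊢ A → Γ ⊢ B
  ⊥E    : ∀ {A} → Γ ⊢ ⊥' → Γ ⊢ A
  -- □-intro: from deductions of □A₁,…,□Aₙ and a deduction of B from
  -- A₁,…,Aₙ together with (undischarged) assumptions Δ ⊆ Γ, infer □B,
  -- discharging A₁,…,Aₙ (n ≥ 0).
  □I    : ∀ {B} (As : List Form) → All (λ A → Γ ⊢ □ A) As → (As ++ Γ) ⊢ B → Γ ⊢ □ B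

module Submission where

open import Defs
open import Data.Empty using (⊥)
open import Data.List using (List; [])
open import Data.List.Relation.Unary.All using (All; []; _∷_; lookup)
open import Data.List.Relation.Unary.All.Properties using (++⁺)
open import Data.Product using (_×_; _,_; proj₁; proj₂)
open import Data.Sum using (_⊎_; inj₁; inj₂)
open import Data.Unit using (⊤)
open import Relation.Nullary using (¬_)

-- Interpret formulas as types, reading □ as the identity modality and every
-- atom as inhabited. The □ rule is then sound because ⟦ □ Aᵢ ⟧ = ⟦ Aᵢ ⟧
-- supplies the discharged assumptions Aᵢ, so every closed deduction yields an
-- inhabitant of its conclusion, and ⟦ ⊥' ⟧ is empty.

⟦_⟧ : Form → Set
⟦ atom _ ⟧ = ⊤
⟦ ⊥' ⟧     = ⊥
⟦ A ∧ B ⟧  = ⟦ A ⟧ × ⟦ B ⟧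
⟦ A ∨ B ⟧  = ⟦ A ⟧ ⊎ ⟦ B ⟧
⟦ A ⇒ B ⟧  = ⟦ A ⟧ → ⟦ B ⟧
⟦ □ A ⟧    = ⟦ A ⟧

Env : Ctx → Set
Env Γ = All ⟦_⟧ Γ

mutual
  ⊢-sound : ∀ {Γ A} → Γ ⊢ A → Env Γ → ⟦ A ⟧
  ⊢-sound (hyp A∈Γ)   ρ = lookup ρ A∈Γ
  ⊢-sound (∧I d e)    ρ = ⊢-sound d ρ , ⊢-sound e ρ
  ⊢-sound (∧E₁ d)     ρ = proj₁ (⊢-sound d ρ)
  ⊢-sound (∧E₂ d)     ρ = proj₂ (⊢-sound d ρ)
  ⊢-sound (∨I₁ d)     ρ = inj₁ (⊢-sound d ρ)
  ⊢-sound (∨I₂ d)     ρ = inj₂ (⊢-sound d ρ)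
  ⊢-sound (∨E d e f)  ρ with ⊢-sound d ρ
  ... | inj₁ a = ⊢-sound e (a ∷ ρ)
  ... | inj₂ b = ⊢-sound f (b ∷ ρ)
  ⊢-sound (⇒I d)      ρ = λ a → ⊢-sound d (a ∷ ρ)
  ⊢-sound (⇒E d e)    ρ = ⊢-sound d ρ (⊢-sound e ρ)
  ⊢-sound (⊥E d)      ρ with ⊢-sound d ρ
  ... | ()
  ⊢-sound (□I As ds d) ρ = ⊢-sound d (++⁺ (□-premises-sound ds ρ) ρ)

  □-premises-sound : ∀ {Γ} {As : List Form} →
                     All (λ A → Γ ⊢ □ A) As → Env Γ → Env As
  □-premises-sound []       ρ = []
  □-premises-sound (d ∷ ds) ρ = ⊢-sound d ρ ∷ □-premises-sound ds ρ

lemma31 : ¬ ([] ⊢ ⊥')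
lemma31 d = ⊢-sound d []
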